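{- Let $G$ be a finite, simple, connected, non-bipartite graph and let $\Gamma=\{g_1,g_2,\dots,g_k\}$ be a finite abelian group (written additively), where $k=|\Gamma|$. Let $c_0$ be any vertex coloring of $G$ with colors from $\Gamma$, with color classes $U_1,\dots,U_k$, where $U_i=\{v\in V(G): c_0(v)=g_i\}$ and $n_i=|U_i|$ for $1\le i\le k$. If there exists an element $h\in\Gamma$ such that $n_1g_1+\dots+n_kg_k=2h$, then there is an edge-weighting $w:E(G)\to\Gamma$ such that the induced vertex coloring equals $c_0$, i.e. $\sum_{e\ni v} w(e)=c_0(v)$ for every $v\in V(G)$.
   Context: For an edge-weighting $w:E(G)\to\Gamma$, the induced vertex coloring assigns to each vertex $v$ the sum (in $\Gamma$) of the weights of the edges incident to $v$. The coloring $c_0$ need not be proper. -}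

module Defs where

open import Level using (Level; _⊔_)
open import Data.Nat using (ℕ; zero; suc)
open import Data.Bool using (Bool; true; false; if_then_else_)
open import Data.Fin using (Fin; _≟_)
open import Data.Empty using (⊥)
open import Data.Product using (∃; _×_; _,_)
open import Relation.Nullary using (¬_; does)
open import Relation.Binary.PropositionalEquality using (_≡_; _≢_)
import Relation.Binary.PropositionalEquality as ≡
open import Function.Bundles using (Inverse)
open import Algebra.Bundles using (AbelianGroup)
import Algebra.Definitions.RawMonoid as RawMonoidDefs

-- Finite simple graphs on the vertex set Fin n.
-- adj u v = true  iff  {u,v} is an edge.  Simple: symmetric, loopless
-- (no multi-edges, since adjacency is a relation).

record SimpleGraph (n : ℕ) : Set where
  field
    adj      : Fin n → Fin n → Bool
    adj-sym  : ∀ u v → adj u v ≡ adj v u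
    loopless : ∀ v → adj v v ≡ false

open SimpleGraph public

data Walk {n : ℕ} (G : SimpleGraph n) : Fin n → Fin n → Set where
  nil  : ∀ {u} → Walk G u u
  cons : ∀ {u w v} → adj G u w ≡ true → Walk G w v → Walk G u v

-- Connected: every pair of vertices is joined by a walk.
-- (The empty graph on 0 vertices counts as connected here; it is
-- bipartite anyway, so it is excluded by the non-bipartite hypothesis.)
Connected : ∀ {n} → SimpleGraph n → Set
Connected {n} G = (u v : Fin n) → Walk G u v

Bipartite : ∀ {n} → SimpleGraph n → Set
Bipartite {n} G =
  ∃ λ (side : Fin n → Bool) → ∀ u v → adj G u v ≡ true → side u ≢ side v

count : ∀ (n : ℕ) {P : Fin n → Set} → (∀ v → Relation.Nullary.Dec (P v)) → ℕ
count zero    P? = zero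
count (suc n) P? =
  (if does (P? Fin.zero) then suc zero else zero) Data.Nat.+ count n (λ v → P? (Fin.suc v))
  where import Data.Fin as Fin
        import Data.Nat

module _ {c ℓ : Level} (Γ : AbelianGroup c ℓ) where
  open AbelianGroup Γ
  open RawMonoidDefs rawMonoid using (sum) renaming (_×_ to _·ℕ_) public

  -- An enumeration Γ = {g_1,…,g_k} with k = |Γ|: a bijection between
  -- Γ (with its setoid equality) and Fin k.
  Enumeration : ℕ → Set (c ⊔ ℓ)
  Enumeration k = Inverse setoid (≡.setoid (Fin k))

  -- An edge-weighting
  -- w : E(G) → Γ is represented by a symmetric function on vertex
  -- pairs (only its values on edges are ever used):
  --   induced v = Σ_{u adjacent to v} w(v,u).
  induced : ∀ {n} → SimpleGraph n → (Fin n → Fin n → Carrier) → Fin n → Carrier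
  induced G w v = sum (λ u → if adj G v u then w v u else ε)

  IsEdgeWeighting : ∀ {n} → SimpleGraph n → (Fin n → Fin n → Carrier) → Set ℓ
  IsEdgeWeighting {n} G w = ∀ u v → w u v ≈ w v u

  classSize : ∀ {n k} → Enumeration k → (Fin n → Carrier) → Fin k → ℕ
  classSize {n} e c₀ i = count n (λ v → Inverse.to e (c₀ v) ≟ i)

  weightedClassSum : ∀ {n k} → Enumeration k → (Fin n → Carrier) → Carrier
  weightedClassSum e c₀ = sum (λ i → classSize e c₀ i ·ℕ Inverse.from e i)

-- Fix a root r.  Weighting the edges of a walk from u to v alternately by
-- x, x⁻¹, x, … induces x at u, ε at every interior visit, and x or x⁻¹ at v
-- according as the walk has odd or even length.  In a connected
-- non-bipartite graph every vertex has an even walk to r and there is an odd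
-- closed walk at r.  Summing, over all v, the alternating weightings of even
-- walks v → r started with c₀ v induces c₀ except at r, where the colour is
-- off by (Σ_v c₀ v)⁻¹; an odd closed walk at r started with h adds h ∙ h
-- there, and Σ_v c₀ v = Σ_i n_i g_i = h ∙ h.
module Submission where

open import Defs
open import Level using (Level)
open import Data.Nat using (ℕ)
open import Data.Fin using (Fin)
open import Data.Product using (∃; _×_)
open import Relation.Nullary using (¬_)
open import Algebra.Bundles using (AbelianGroup)

open import Data.Nat as Nat using (zero; suc)
open import Data.Fin using (zero; suc; _≟_)
open import Data.Fin.Properties using (any?)
open import Data.Bool as Bool using (Bool; true; false; not; _xor_; if_then_else_)
open import Data.Bool.Properties using (not-distribˡ-xor; xor-comm; xor-inverseʳ)
open import Data.Product using (Σ; _,_; proj₁; proj₂)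
open import Data.Empty using (⊥-elim)
open import Relation.Nullary using (yes; no; does; _×-dec_)
open import Relation.Binary.PropositionalEquality as ≡ using (_≡_; refl)
open import Function.Bundles using (Inverse)

module _ {n : ℕ} (G : SimpleGraph n) where

  odd : ∀ {u v} → Walk G u v → Bool
  odd nil        = false
  odd (cons _ p) = not (odd p)

  _++_ : ∀ {u v w} → Walk G u v → Walk G v w → Walk G u w
  nil      ++ q = q
  cons e p ++ q = cons e (p ++ q)

  odd-++ : ∀ {u v w} (p : Walk G u v) (q : Walk G v w) → odd (p ++ q) ≡ odd p xor odd q
  odd-++ nil        q = refl
  odd-++ (cons e p) q = ≡.trans (≡.cong not (odd-++ p q)) (not-distribˡ-xor (odd p) (odd q))

  reverse : ∀ {u v} → Walk G u v → Walk G v u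
  reverse nil                = nil
  reverse (cons {u} {w} e p) = reverse p ++ cons (≡.trans (adj-sym G w u) e) nil

  odd-reverse : ∀ {u v} (p : Walk G u v) → odd (reverse p) ≡ odd p
  odd-reverse nil        = refl
  odd-reverse (cons e p) = ≡.trans (odd-++ (reverse p) _)
    (≡.trans (xor-comm (odd (reverse p)) true) (≡.cong not (odd-reverse p)))

  WalkOfParity : Fin n → Fin n → Bool → Set
  WalkOfParity u v b = Σ (Walk G u v) λ p → odd p ≡ b

  monochromaticEdge : ¬ Bipartite G → (side : Fin n → Bool) →
                      ∃ λ u → ∃ λ v → adj G u v ≡ true × side u ≡ side v
  monochromaticEdge nb side
    with any? (λ u → any? (λ v → (adj G u v Bool.≟ true) ×-dec (side u Bool.≟ side v)))
  ... | yes edge = edge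
  ... | no none  = ⊥-elim (nb (side , λ u v uv same → none (u , v , uv , same)))

  -- Colour v by the parity of a walk from r; a monochromatic edge then closes
  -- an odd circuit through r.
  oddClosedWalk : Connected G → ¬ Bipartite G → ∀ r → WalkOfParity r r true
  oddClosedWalk conn nb r with monochromaticEdge nb (λ v → odd (conn r v))
  ... | u , v , uv , same = conn r u ++ cons uv (reverse (conn r v)) , circuit-odd
    where
    circuit-odd : odd (conn r u ++ cons uv (reverse (conn r v))) ≡ true
    circuit-odd rewrite odd-++ (conn r u) (cons uv (reverse (conn r v)))
                      | odd-reverse (conn r v) | same = xor-inverseʳ (odd (conn r v))

  evenWalk : Connected G → ∀ {r} → WalkOfParity r r true → ∀ v → WalkOfParity v r false
  evenWalk conn {r} (C , C-odd) v with odd (conn v r) in p-odd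
  ... | false = conn v r , p-odd
  ... | true  = conn v r ++ C , ≡.trans (odd-++ (conn v r) C) (≡.cong₂ _xor_ p-odd C-odd)

module _ {c ℓ : Level} (Γ : AbelianGroup c ℓ) where

  open AbelianGroup Γ renaming (refl to ≈-refl; sym to ≈-sym; trans to ≈-trans)
  open import Algebra.Properties.CommutativeMonoid.Sum commutativeMonoid
    using (sum-cong-≋; sum-replicate-zero; ∑-distrib-+; ∑-comm)
  open import Algebra.Properties.Monoid.Mult monoid using (×-homo-+)
  open import Algebra.Properties.AbelianGroup Γ using (⁻¹-∙-comm)
  open import Algebra.Properties.Group group using (ε⁻¹≈ε; ⁻¹-involutive)
  open import Relation.Binary.Reasoning.Setoid setoid

  when : Bool → Carrier → Carrier
  when b x = if b then x else ε

  when-cong : ∀ b {x y} → x ≈ y → when b x ≈ when b y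
  when-cong true  x≈y = x≈y
  when-cong false x≈y = ≈-refl

  when-ε : ∀ b → when b ε ≈ ε
  when-ε true  = ≈-refl
  when-ε false = ≈-refl

  when-∙ : ∀ b x y → when b (x ∙ y) ≈ when b x ∙ when b y
  when-∙ true  x y = ≈-refl
  when-∙ false x y = ≈-sym (identityˡ ε)

  when-comm : ∀ a b x → when a (when b x) ≡ when b (when a x)
  when-comm true  true  x = refl
  when-comm true  false x = refl
  when-comm false true  x = refl
  when-comm false false x = refl

  when-redundant : ∀ b {x} → (b ≡ false → x ≈ ε) → when b x ≈ x
  when-redundant true  x≈ε = ≈-refl
  when-redundant false x≈ε = ≈-sym (x≈ε refl)

  ∑-when : ∀ {m} b (f : Fin m → Carrier) → sum Γ (λ i → when b (f i)) ≈ when b (sum Γ f)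
  ∑-when     true  f = ≈-refl
  ∑-when {m} false f = sum-replicate-zero m

  ∑-⁻¹ : ∀ {m} (f : Fin m → Carrier) → sum Γ (λ i → f i ⁻¹) ≈ sum Γ f ⁻¹
  ∑-⁻¹ {zero}  f = ≈-sym ε⁻¹≈ε
  ∑-⁻¹ {suc m} f = ≈-trans (∙-congˡ (∑-⁻¹ (λ i → f (suc i)))) (⁻¹-∙-comm _ _)

  δ : ∀ {m} → Fin m → Carrier → Fin m → Carrier
  δ a x t = when (does (a ≟ t)) x

  ∑-δ : ∀ {m} (a : Fin m) (f : Fin m → Carrier) → sum Γ (λ i → when (does (a ≟ i)) (f i)) ≈ f a
  ∑-δ {suc m} zero    f = ≈-trans (∙-congˡ (sum-replicate-zero m)) (identityʳ _)
  ∑-δ {suc m} (suc a) f = ≈-trans (identityˡ _) (∑-δ a (λ i → f (suc i)))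

  ∑-δ′ : ∀ {m} (a : Fin m) (f : Fin m → Carrier) → sum Γ (λ i → when (does (i ≟ a)) (f i)) ≈ f a
  ∑-δ′ {suc m} zero    f = ≈-trans (∙-congˡ (sum-replicate-zero m)) (identityʳ _)
  ∑-δ′ {suc m} (suc a) f = ≈-trans (identityˡ _) (∑-δ′ a (λ i → f (suc i)))

  δ-⁻¹ : ∀ {m} (a : Fin m) x t → δ a x t ∙ δ a (x ⁻¹) t ≈ ε
  δ-⁻¹ a x t with does (a ≟ t)
  ... | true  = inverseʳ x
  ... | false = identityˡ ε

  ∑-fibres : ∀ {m k} (φ : Fin m → Fin k) (g : Fin k → Carrier) →
             sum Γ (λ i → _·ℕ_ Γ (count m (λ v → φ v ≟ i)) (g i)) ≈ sum Γ (λ v → g (φ v))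
  ∑-fibres {zero}  {k} φ g = sum-replicate-zero k
  ∑-fibres {suc m} {k} φ g = begin
      sum Γ (λ i → _·ℕ_ Γ (indicator i Nat.+ rest i) (g i))
    ≈⟨ sum-cong-≋ (λ i → ×-homo-+ (g i) (indicator i) (rest i)) ⟩
      sum Γ (λ i → _·ℕ_ Γ (indicator i) (g i) ∙ _·ℕ_ Γ (rest i) (g i))
    ≈⟨ ∑-distrib-+ (λ i → _·ℕ_ Γ (indicator i) (g i)) (λ i → _·ℕ_ Γ (rest i) (g i)) ⟩
      sum Γ (λ i → _·ℕ_ Γ (indicator i) (g i)) ∙ sum Γ (λ i → _·ℕ_ Γ (rest i) (g i))
    ≈⟨ ∙-cong (≈-trans (sum-cong-≋ (λ i → one-times (does (φ zero ≟ i)) (g i))) (∑-δ (φ zero) g))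
              (∑-fibres (λ v → φ (suc v)) g) ⟩
      g (φ zero) ∙ sum Γ (λ v → g (φ (suc v)))
    ∎
    where
    indicator rest : Fin k → ℕ
    indicator i = if does (φ zero ≟ i) then 1 else 0
    rest i      = count m (λ v → φ (suc v) ≟ i)
    one-times : ∀ b y → _·ℕ_ Γ (if b then 1 else 0) y ≈ when b y
    one-times true  y = identityʳ y
    one-times false y = ≈-refl

  weightedClassSum≈sum : ∀ {m k} (e : Enumeration Γ k) (c₀ : Fin m → Carrier) →
                         weightedClassSum Γ e c₀ ≈ sum Γ c₀
  weightedClassSum≈sum e c₀ =
    ≈-trans (∑-fibres (λ v → Inverse.to e (c₀ v)) (Inverse.from e))
            (sum-cong-≋ {x = λ v → Inverse.from e (Inverse.to e (c₀ v))} {y = c₀} (λ v → Inverse.inverseʳ e refl))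

  module _ {n : ℕ} (G : SimpleGraph n) where

    Weighting : Set c
    Weighting = Fin n → Fin n → Carrier

    _⊕_ : Weighting → Weighting → Weighting
    (w₁ ⊕ w₂) u v = w₁ u v ∙ w₂ u v

    ∑ʷ : ∀ {m} → (Fin m → Weighting) → Weighting
    ∑ʷ ws u v = sum Γ (λ i → ws i u v)

    induced-⊕ : ∀ w₁ w₂ t → induced Γ G (w₁ ⊕ w₂) t ≈ induced Γ G w₁ t ∙ induced Γ G w₂ t
    induced-⊕ w₁ w₂ t =
      ≈-trans (sum-cong-≋ (λ u → when-∙ (adj G t u) (w₁ t u) (w₂ t u)))
              (∑-distrib-+ (λ u → when (adj G t u) (w₁ t u)) (λ u → when (adj G t u) (w₂ t u)))

    induced-ε : ∀ t → induced Γ G (λ _ _ → ε) t ≈ ε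
    induced-ε t = ≈-trans (sum-cong-≋ (λ u → when-ε (adj G t u))) (sum-replicate-zero n)

    induced-∑ : ∀ {m} (ws : Fin m → Weighting) t →
                induced Γ G (∑ʷ ws) t ≈ sum Γ (λ i → induced Γ G (ws i) t)
    induced-∑ ws t =
      ≈-trans (sum-cong-≋ (λ u → ≈-sym (∑-when (adj G t u) (λ i → ws i t u))))
              (∑-comm (λ u i → when (adj G t u) (ws i t u)))

    edge : Fin n → Fin n → Carrier → Weighting
    edge a b x u v = δ a (δ b x v) u ∙ δ b (δ a x v) u

    edge-sym : ∀ a b x → IsEdgeWeighting Γ G (edge a b x)
    edge-sym a b x u v = ≈-trans (comm _ _)
      (∙-cong (reflexive (when-comm (does (b ≟ u)) (does (a ≟ v)) x))
              (reflexive (when-comm (does (a ≟ u)) (does (b ≟ v)) x)))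

    edge-nonadjacent : ∀ {a b} x t u → adj G a b ≡ true → adj G t u ≡ false → δ a (δ b x u) t ≈ ε
    edge-nonadjacent {a} {b} x t u ab tu with a ≟ t | b ≟ u
    ... | yes refl | yes refl with () ← ≡.trans (≡.sym ab) tu
    ... | yes _    | no _     = ≈-refl
    ... | no _     | _        = ≈-refl

    induced-edge : ∀ {a b} x → adj G a b ≡ true → ∀ t → induced Γ G (edge a b x) t ≈ δ a x t ∙ δ b x t
    induced-edge {a} {b} x ab t = begin
        sum Γ (λ u → when (adj G t u) (edge a b x t u))
      ≈⟨ sum-cong-≋ (λ u → when-redundant (adj G t u) (λ tu →
           ≈-trans (∙-cong (edge-nonadjacent x t u ab tu) (edge-nonadjacent x t u ba tu)) (identityˡ ε))) ⟩
        sum Γ (λ u → δ a (δ b x u) t ∙ δ b (δ a x u) t)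
      ≈⟨ ∑-distrib-+ (λ u → δ a (δ b x u) t) (λ u → δ b (δ a x u) t) ⟩
        sum Γ (λ u → δ a (δ b x u) t) ∙ sum Γ (λ u → δ b (δ a x u) t)
      ≈⟨ ∙-cong (≈-trans (∑-when (does (a ≟ t)) (δ b x)) (when-cong (does (a ≟ t)) (∑-δ b (λ _ → x))))
                (≈-trans (∑-when (does (b ≟ t)) (δ a x)) (when-cong (does (b ≟ t)) (∑-δ a (λ _ → x)))) ⟩
        δ a x t ∙ δ b x t
      ∎
      where
      ba : adj G b a ≡ true
      ba = ≡.trans (adj-sym G b a) ab

    alternating : ∀ {u v} → Walk G u v → Carrier → Weighting
    alternating nil                x = λ _ _ → ε
    alternating (cons {u} {w} e p) x = edge u w x ⊕ alternating p (x ⁻¹)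

    alternating-sym : ∀ {u v} (p : Walk G u v) x → IsEdgeWeighting Γ G (alternating p x)
    alternating-sym nil                x s t = ≈-refl
    alternating-sym (cons {u} {w} e p) x s t =
      ∙-cong (edge-sym u w x s t) (alternating-sym p (x ⁻¹) s t)

    -- The value the alternation would place on one more edge after the walk.
    terminal : ∀ {u v} → Walk G u v → Carrier → Carrier
    terminal nil        x = x ⁻¹
    terminal (cons e p) x = terminal p (x ⁻¹)

    terminal-parity : ∀ {u v} (p : Walk G u v) x → terminal p x ≈ (if odd G p then x else x ⁻¹)
    terminal-parity nil        x = ≈-refl
    terminal-parity (cons e p) x with odd G p | terminal-parity p (x ⁻¹)
    ... | true  | hyp = hyp
    ... | false | hyp = ≈-trans hyp (⁻¹-involutive x)

    terminal-even : ∀ {u v} (p : Walk G u v) x → odd G p ≡ false → terminal p x ≈ x ⁻¹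
    terminal-even p x even = ≡.subst (λ b → terminal p x ≈ (if b then x else x ⁻¹)) even (terminal-parity p x)

    terminal-odd : ∀ {u v} (p : Walk G u v) x → odd G p ≡ true → terminal p x ≈ x
    terminal-odd p x odd-p = ≡.subst (λ b → terminal p x ≈ (if b then x else x ⁻¹)) odd-p (terminal-parity p x)

    induced-alternating : ∀ {u v} (p : Walk G u v) x t →
                          induced Γ G (alternating p x) t ≈ δ u x t ∙ δ v (terminal p x) t
    induced-alternating {u} nil x t = ≈-trans (induced-ε t) (≈-sym (δ-⁻¹ u x t))
    induced-alternating {u} {v} (cons {u} {w} e p) x t = begin
        induced Γ G (edge u w x ⊕ alternating p (x ⁻¹)) t
      ≈⟨ induced-⊕ (edge u w x) (alternating p (x ⁻¹)) t ⟩
        induced Γ G (edge u w x) t ∙ induced Γ G (alternating p (x ⁻¹)) t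
      ≈⟨ ∙-cong (induced-edge x e t) (induced-alternating p (x ⁻¹) t) ⟩
        (δ u x t ∙ δ w x t) ∙ (δ w (x ⁻¹) t ∙ δ v (terminal p (x ⁻¹)) t)
      ≈⟨ assoc _ _ _ ⟩
        δ u x t ∙ (δ w x t ∙ (δ w (x ⁻¹) t ∙ δ v (terminal p (x ⁻¹)) t))
      ≈⟨ ∙-congˡ (≈-sym (assoc _ _ _)) ⟩
        δ u x t ∙ ((δ w x t ∙ δ w (x ⁻¹) t) ∙ δ v (terminal p (x ⁻¹)) t)
      ≈⟨ ∙-congˡ (≈-trans (∙-congʳ (δ-⁻¹ w x t)) (identityˡ _)) ⟩
        δ u x t ∙ δ v (terminal p (x ⁻¹)) t
      ∎

    realiseColouring : Connected G → ¬ Bipartite G → (r : Fin n) (c₀ : Fin n → Carrier) (h : Carrier) →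
              sum Γ c₀ ≈ h ∙ h → ∃ λ w → IsEdgeWeighting Γ G w × (∀ t → induced Γ G w t ≈ c₀ t)
    realiseColouring conn nb r c₀ h total = w , w-sym , w-induced
      where
      C : WalkOfParity G r r true
      C = oddClosedWalk G conn nb r

      E : ∀ v → WalkOfParity G v r false
      E = evenWalk G conn C

      towardsRoot : Weighting
      towardsRoot = ∑ʷ (λ v → alternating (proj₁ (E v)) (c₀ v))

      w : Weighting
      w = towardsRoot ⊕ alternating (proj₁ C) h

      w-sym : IsEdgeWeighting Γ G w
      w-sym s t = ∙-cong (sum-cong-≋ (λ v → alternating-sym (proj₁ (E v)) (c₀ v) s t))
                         (alternating-sym (proj₁ C) h s t)

      induced-towardsRoot : ∀ t → induced Γ G towardsRoot t ≈ c₀ t ∙ δ r (sum Γ c₀ ⁻¹) t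
      induced-towardsRoot t = begin
          induced Γ G towardsRoot t
        ≈⟨ induced-∑ (λ v → alternating (proj₁ (E v)) (c₀ v)) t ⟩
          sum Γ (λ v → induced Γ G (alternating (proj₁ (E v)) (c₀ v)) t)
        ≈⟨ sum-cong-≋ (λ v → ≈-trans (induced-alternating (proj₁ (E v)) (c₀ v) t)
             (∙-congˡ (when-cong (does (r ≟ t)) (terminal-even (proj₁ (E v)) (c₀ v) (proj₂ (E v)))))) ⟩
          sum Γ (λ v → δ v (c₀ v) t ∙ δ r (c₀ v ⁻¹) t)
        ≈⟨ ∑-distrib-+ (λ v → δ v (c₀ v) t) (λ v → δ r (c₀ v ⁻¹) t) ⟩
          sum Γ (λ v → δ v (c₀ v) t) ∙ sum Γ (λ v → δ r (c₀ v ⁻¹) t)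
        ≈⟨ ∙-cong (∑-δ′ t c₀) (≈-trans (∑-when (does (r ≟ t)) (λ v → c₀ v ⁻¹))
                                       (when-cong (does (r ≟ t)) (∑-⁻¹ c₀))) ⟩
          c₀ t ∙ δ r (sum Γ c₀ ⁻¹) t
        ∎

      induced-oddCircuit : ∀ t → induced Γ G (alternating (proj₁ C) h) t ≈ δ r (h ∙ h) t
      induced-oddCircuit t = ≈-trans (induced-alternating (proj₁ C) h t)
        (≈-trans (∙-congˡ (when-cong (does (r ≟ t)) (terminal-odd (proj₁ C) h (proj₂ C))))
                 (≈-sym (when-∙ (does (r ≟ t)) h h)))

      w-induced : ∀ t → induced Γ G w t ≈ c₀ t
      w-induced t = begin
          induced Γ G w t
        ≈⟨ ≈-trans (induced-⊕ towardsRoot (alternating (proj₁ C) h) t)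
                   (∙-cong (induced-towardsRoot t) (induced-oddCircuit t)) ⟩
          (c₀ t ∙ δ r (sum Γ c₀ ⁻¹) t) ∙ δ r (h ∙ h) t
        ≈⟨ ≈-trans (assoc _ _ _) (∙-congˡ (≈-sym (when-∙ (does (r ≟ t)) _ _))) ⟩
          c₀ t ∙ δ r (sum Γ c₀ ⁻¹ ∙ (h ∙ h)) t
        ≈⟨ ∙-congˡ (when-cong (does (r ≟ t)) (≈-trans (∙-congˡ (≈-sym total)) (inverseˡ (sum Γ c₀)))) ⟩
          c₀ t ∙ δ r ε t
        ≈⟨ ≈-trans (∙-congˡ (when-ε (does (r ≟ t)))) (identityʳ (c₀ t)) ⟩
          c₀ t
        ∎

theorem2p2 : {c ℓ : Level} (Γ : AbelianGroup c ℓ) (k : ℕ) (e : Enumeration Γ k)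
    {n : ℕ} (G : SimpleGraph n) → Connected G → ¬ Bipartite G →
    (c₀ : Fin n → AbelianGroup.Carrier Γ) →
    (∃ λ (h : AbelianGroup.Carrier Γ) →
      AbelianGroup._≈_ Γ (weightedClassSum Γ e c₀) (AbelianGroup._∙_ Γ h h)) →
    ∃ λ (w : Fin n → Fin n → AbelianGroup.Carrier Γ) →
      IsEdgeWeighting Γ G w × (∀ v → AbelianGroup._≈_ Γ (induced Γ G w v) (c₀ v))
theorem2p2 Γ k e {zero}  G conn nb c₀ _ = ⊥-elim (nb ((λ ()) , λ ()))
theorem2p2 Γ k e {suc m} G conn nb c₀ (h , classSum≈2h) =
  realiseColouring Γ G conn nb zero c₀ h (trans (sym (weightedClassSum≈sum Γ e c₀)) classSum≈2h)
  where open AbelianGroup Γ using (sym; trans)
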